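{- Let $\mathbf{a}=(a_1,a_2,\ldots)$ and $\mathbf{e}=(e_1,e_2,\ldots)$ be arbitrary real sequences (both infinite, or both of length $n$, in which case the network is truncated to rows $0,\ldots,n$) with $a_1=e_1$. Consider the weighted network described in the context with weights $x_{m1}=a_1-e_1$ for all $m\ge1$ and $x_{mk}=a_k-e_{m-k+2}$ for all $m\ge k\ge2$. Then its path matrix equals $S^{\mathbf{a},\mathbf{e}}$.
   Context: The network: for each integer $i\ge0$ there is a source $s_i$, a sink $t_i$, and vertices $v(i,1),\ldots,v(i,i+1)$; horizontal directed edges $s_i\to v(i,1)\to\cdots\to v(i,i+1)\to t_i$, all of weight $1$; and for each $m\ge k\ge1$ a vertical directed edge $v(m,k)\to v(m-1,k)$ of weight $x_{mk}$. The path matrix is the matrix indexed by $\{0,1,2,\ldots\}$ whose $(i,j)$ entry is the sum over all directed paths from $s_i$ to $t_j$ of the product of edge weights along the path. The matrix $S^{\mathbf{a},\mathbf{e}}$ has entries defined by $\prod_{i=1}^m(x-e_i)=\sum_{k=0}^m S^{\mathbf{a},\mathbf{e}}(m,k)\prod_{i=1}^k(x-a_i)$ for $m\ge0$, with $S^{\mathbf{a},\mathbf{e}}(m,k)=0$ for $k>m$. -}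

module Defs where

open import Level using (Level; _⊔_)
open import Algebra.Bundles using (CommutativeRing)
open import Data.Nat using (ℕ; zero; suc; _∸_; _<_) renaming (_+_ to _+ℕ_)
open import Data.Nat using (_≟_)
open import Data.List using (List; []; _∷_)
open import Data.Product using (_×_)
open import Relation.Nullary using (yes; no)

module _ {c ℓ : Level} (R : CommutativeRing c ℓ) where
  open CommutativeRing R hiding (zero)

  -- Polynomials over R as coefficient lists (constant term first).
  Poly : Set c
  Poly = List Carrier

  coeff : Poly → ℕ → Carrier
  coeff []       _       = 0#
  coeff (p ∷ ps) zero    = p
  coeff (p ∷ ps) (suc n) = coeff ps n

  _+ₚ_ : Poly → Poly → Poly
  []       +ₚ q        = q
  (p ∷ ps) +ₚ []       = p ∷ ps
  (p ∷ ps) +ₚ (q ∷ qs) = (p + q) ∷ (ps +ₚ qs)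

  scaleₚ : Carrier → Poly → Poly
  scaleₚ s []       = []
  scaleₚ s (p ∷ ps) = (s * p) ∷ scaleₚ s ps

  mulLin : Carrier → Poly → Poly
  mulLin b p = (0# ∷ p) +ₚ scaleₚ (- b) p

  -- ∏_{i=1}^m (x - u_i), sequences indexed from 1 (index 0 unused)
  prodLin : (ℕ → Carrier) → ℕ → Poly
  prodLin u zero    = 1# ∷ []
  prodLin u (suc m) = mulLin (u (suc m)) (prodLin u m)

  sumTo : ℕ → (ℕ → Carrier) → Carrier
  sumTo zero    f = f 0
  sumTo (suc m) f = sumTo m f + f (suc m)

  IsSae : (a e : ℕ → Carrier) → (ℕ → ℕ → Carrier) → Set ℓ
  IsSae a e S =
    (m : ℕ) →
      ((k : ℕ) → m < k → S m k ≈ 0#)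
      × ((n : ℕ) → coeff (prodLin e m) n
                     ≈ sumTo m (λ k → S m k * coeff (prodLin a k) n))

  -- Vertex v(m,k) is encoded by (m , r) with r = m + 1 - k,
  -- so r ranges over 0..m.  Given vertical weights x m k (weight of the
  -- edge v(m,k) → v(m-1,k)), pathsFrom x m r j is the sum over all
  -- directed paths from v(m, m+1-r) to t_j of the product of edge weights,
  -- computed by the first-step decomposition:
  --   * horizontal edge (weight 1): to t_m if r = 0, else to v(m,k+1);
  --   * vertical edge v(m,k) → v(m-1,k), present iff k ≤ m (i.e. r ≥ 1),
  --     leading to (m-1 , r-1).
  pathsFrom : (ℕ → ℕ → Carrier) → ℕ → ℕ → ℕ → Carrier
  pathsFrom x m zero j with m ≟ j
  ... | yes _ = 1#
  ... | no  _ = 0#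
  pathsFrom x zero    (suc r) j = pathsFrom x zero r j   -- unreachable (r ≤ m)
  pathsFrom x (suc m) (suc r) j =
    1# * pathsFrom x (suc m) r j
    + x (suc m) (suc m ∸ r) * pathsFrom x m r j

  -- Path matrix: (i,j) entry = sum over paths s_i → t_j; the only edge
  -- out of s_i is s_i → v(i,1) (weight 1), and v(i,1) is (i , i).
  pathMatrix : (ℕ → ℕ → Carrier) → ℕ → ℕ → Carrier
  pathMatrix x i j = 1# * pathsFrom x i i j

  lemmaWeights : (a e : ℕ → Carrier) → ℕ → ℕ → Carrier
  lemmaWeights a e m zero          = 0#   -- no such edge (k ≥ 1)
  lemmaWeights a e m (suc zero)    = a 1 - e 1
  lemmaWeights a e m (suc (suc k)) = a (suc (suc k)) - e ((m ∸ suc (suc k)) +ℕ 2)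

-- Write A_k = ∏_{i≤k} (x - a_i) and E_k = ∏_{i≤k} (x - e_i).  For a vertex
-- v of row m let P(v) = Σ_j (paths v → t_j) · A_j, the "path polynomial"
-- of v.  Splitting paths by their first edge gives the recurrence
--   P(v(m+1,k)) = P(v(m+1,k+1)) + x_{m+1,k} · P(v(m,k)),
-- and the last vertex of row m has P = A_m.  Induction on the distance r
-- from the end of the row shows (with a₁ = e₁)
--   P(v(r+k-1,k)) = A_{k-1} · (x - e₂)⋯(x - e_{r+1})   for k ≥ 2,
--   P(v(r,1))     = E_r,
-- the induction step being the identity (x-a)f + (a-e)f = (x-e)f.
-- Hence Σ_j (path matrix)_{ij} A_j = E_i = Σ_j S_{ij} A_j, and since the
-- A_j are monic of degree j the coefficients agree.
module Submission where

open import Defs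
open import Level using (Level)
open import Algebra.Bundles using (CommutativeRing)
open import Data.Nat using (ℕ; zero; suc; _<_; _≤_; z≤n; s≤s; _∸_; _≟_; _≤?_)
  renaming (_+_ to _+ℕ_)
import Data.Nat.Properties as ℕₚ
open import Data.List using ([]; _∷_)
open import Data.Product using (proj₁; proj₂)
open import Data.Sum using (inj₁; inj₂)
open import Relation.Nullary using (Dec; yes; no; ¬_)
import Relation.Binary.PropositionalEquality as P
open import Data.Empty using (⊥-elim)
import Algebra.Solver.Ring.NaturalCoefficients.Default as SemiringSolver
import Relation.Binary.Reasoning.Setoid as SetoidReasoning
import Algebra.Properties.Ring as RingProperties

module Development {c ℓ : Level} (R : CommutativeRing c ℓ) where
  open CommutativeRing R hiding (zero)
  open SemiringSolver commutativeSemiring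
  open SetoidReasoning setoid
  open RingProperties ring using (+-cancelʳ)

  Coeffs : Set c
  Coeffs = ℕ → Carrier

  infix 4 _≋_
  _≋_ : Coeffs → Coeffs → Set ℓ
  f ≋ g = ∀ n → f n ≈ g n

  mulLin′ : Carrier → Coeffs → Coeffs
  mulLin′ b f zero    = - b * f zero
  mulLin′ b f (suc n) = f n + - b * f (suc n)

  coeff-+ₚ : ∀ p q n → coeff R (_+ₚ_ R p q) n ≈ coeff R p n + coeff R q n
  coeff-+ₚ []      q       n       = sym (+-identityˡ _)
  coeff-+ₚ (_ ∷ _) []      n       = sym (+-identityʳ _)
  coeff-+ₚ (_ ∷ _) (_ ∷ _) zero    = refl
  coeff-+ₚ (_ ∷ p) (_ ∷ q) (suc n) = coeff-+ₚ p q n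

  coeff-scaleₚ : ∀ s p n → coeff R (scaleₚ R s p) n ≈ s * coeff R p n
  coeff-scaleₚ s []      n       = sym (zeroʳ s)
  coeff-scaleₚ s (_ ∷ _) zero    = refl
  coeff-scaleₚ s (_ ∷ p) (suc n) = coeff-scaleₚ s p n

  coeff-mulLin : ∀ b p → coeff R (mulLin R b p) ≋ mulLin′ b (coeff R p)
  coeff-mulLin b p zero =
    trans (coeff-+ₚ (0# ∷ p) (scaleₚ R (- b) p) zero)
          (trans (+-identityˡ _) (coeff-scaleₚ (- b) p zero))
  coeff-mulLin b p (suc n) =
    trans (coeff-+ₚ (0# ∷ p) (scaleₚ R (- b) p) (suc n))
          (+-cong refl (coeff-scaleₚ (- b) p (suc n)))

  mulLin′-cong : ∀ {b b′ f g} → b ≈ b′ → f ≋ g → mulLin′ b f ≋ mulLin′ b′ g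
  mulLin′-cong b≈b′ f≋g zero    = *-cong (-‿cong b≈b′) (f≋g 0)
  mulLin′-cong b≈b′ f≋g (suc n) = +-cong (f≋g n) (*-cong (-‿cong b≈b′) (f≋g (suc n)))

  mulLin′-comm : ∀ b b′ f → mulLin′ b (mulLin′ b′ f) ≋ mulLin′ b′ (mulLin′ b f)
  mulLin′-comm b b′ f zero =
    solve 3 (λ u v x → u :* (v :* x) := v :* (u :* x)) refl (- b) (- b′) (f 0)
  mulLin′-comm b b′ f (suc zero) =
    solve 4 (λ u v x y → v :* x :+ u :* (x :+ v :* y) := u :* x :+ v :* (x :+ u :* y))
      refl (- b) (- b′) (f 0) (f 1)
  mulLin′-comm b b′ f (suc (suc n)) =
    solve 5 (λ u v x y z → (x :+ v :* y) :+ u :* (y :+ v :* z)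
                         := (x :+ u :* y) :+ v :* (y :+ u :* z))
      refl (- b) (- b′) (f n) (f (suc n)) (f (suc (suc n)))

  shift-root : ∀ a e y → - a * y + (a - e) * y ≈ - e * y
  shift-root a e y = begin
    - a * y + (a - e) * y  ≈⟨ distribʳ y (- a) (a - e) ⟨
    (- a + (a - e)) * y    ≈⟨ *-cong (+-assoc (- a) a (- e)) refl ⟨
    ((- a + a) - e) * y    ≈⟨ *-cong (+-cong (-‿inverseˡ a) refl) refl ⟩
    (0# - e) * y           ≈⟨ *-cong (+-identityˡ (- e)) refl ⟩
    - e * y                ∎

  -- (x - a)·f + (a - e)·f = (x - e)·f: the identity behind every
  -- induction step of the path computation.
  change-root : ∀ a e f n → mulLin′ a f n + (a - e) * f n ≈ mulLin′ e f n
  change-root a e f zero    = shift-root a e (f 0)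
  change-root a e f (suc n) = trans (+-assoc _ _ _) (+-cong refl (shift-root a e (f (suc n))))

  prodLin-above : ∀ u k n → k < n → coeff R (prodLin R u k) n ≈ 0#
  prodLin-above u zero    (suc n) _ = refl
  prodLin-above u (suc k) (suc n) (s≤s k<n) = begin
    coeff R (prodLin R u (suc k)) (suc n)
      ≈⟨ coeff-mulLin (u (suc k)) (prodLin R u k) (suc n) ⟩
    coeff R (prodLin R u k) n + - u (suc k) * coeff R (prodLin R u k) (suc n)
      ≈⟨ +-cong (prodLin-above u k n k<n)
                (*-cong refl (prodLin-above u k (suc n) (ℕₚ.m≤n⇒m≤1+n k<n))) ⟩
    0# + - u (suc k) * 0#  ≈⟨ +-identityˡ _ ⟩
    - u (suc k) * 0#       ≈⟨ zeroʳ _ ⟩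
    0#                     ∎

  prodLin-leading : ∀ u k → coeff R (prodLin R u k) k ≈ 1#
  prodLin-leading u zero    = refl
  prodLin-leading u (suc k) = begin
    coeff R (prodLin R u (suc k)) (suc k)
      ≈⟨ coeff-mulLin (u (suc k)) (prodLin R u k) (suc k) ⟩
    coeff R (prodLin R u k) k + - u (suc k) * coeff R (prodLin R u k) (suc k)
      ≈⟨ +-cong (prodLin-leading u k)
                (*-cong refl (prodLin-above u k (suc k) (ℕₚ.n<1+n k))) ⟩
    1# + - u (suc k) * 0#  ≈⟨ +-cong refl (zeroʳ _) ⟩
    1# + 0#                ≈⟨ +-identityʳ 1# ⟩
    1#                     ∎

  sumTo-cong : ∀ m {f g : Coeffs} → f ≋ g → sumTo R m f ≈ sumTo R m g
  sumTo-cong zero    f≋g = f≋g 0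
  sumTo-cong (suc m) f≋g = +-cong (sumTo-cong m f≋g) (f≋g (suc m))

  sumTo-+ : ∀ m (f g : Coeffs) → sumTo R m (λ k → f k + g k) ≈ sumTo R m f + sumTo R m g
  sumTo-+ zero    f g = refl
  sumTo-+ (suc m) f g = trans (+-cong (sumTo-+ m f g) refl)
    (solve 4 (λ x y u v → (x :+ y) :+ (u :+ v) := (x :+ u) :+ (y :+ v)) refl
      (sumTo R m f) (sumTo R m g) (f (suc m)) (g (suc m)))

  sumTo-* : ∀ m s (f : Coeffs) → sumTo R m (λ k → s * f k) ≈ s * sumTo R m f
  sumTo-* zero    s f = refl
  sumTo-* (suc m) s f = trans (+-cong (sumTo-* m s f) refl) (sym (distribˡ s _ _))

  sumTo-zero : ∀ m (f : Coeffs) → (∀ k → k ≤ m → f k ≈ 0#) → sumTo R m f ≈ 0#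
  sumTo-zero zero    f f≈0 = f≈0 0 z≤n
  sumTo-zero (suc m) f f≈0 =
    trans (+-cong (sumTo-zero m f (λ k k≤m → f≈0 k (ℕₚ.m≤n⇒m≤1+n k≤m)))
                  (f≈0 (suc m) ℕₚ.≤-refl))
          (+-identityˡ 0#)

  sumTo-last : ∀ m (f : Coeffs) → (∀ k → k < m → f k ≈ 0#) → sumTo R m f ≈ f m
  sumTo-last zero    f _   = refl
  sumTo-last (suc m) f f≈0 =
    trans (+-cong (sumTo-zero m f (λ k k≤m → f≈0 k (s≤s k≤m))) refl) (+-identityˡ _)

  sumTo-init : ∀ m (f : Coeffs) → f (suc m) ≈ 0# → sumTo R (suc m) f ≈ sumTo R m f
  sumTo-init m f f≈0 = trans (+-cong refl f≈0) (+-identityʳ _)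

  module MonicBasis (b : ℕ → Coeffs)
                    (leading : ∀ k → b k k ≈ 1#)
                    (above : ∀ k n → k < n → b k n ≈ 0#) where

    top-coeff : ∀ m (γ : Coeffs) → sumTo R m (λ k → γ k * b k m) ≈ γ m
    top-coeff m γ = trans
      (sumTo-last m _ (λ k k<m → trans (*-cong refl (above k m k<m)) (zeroʳ _)))
      (trans (*-cong refl (leading m)) (*-identityʳ _))

    SameExpansion : ℕ → Coeffs → Coeffs → Set ℓ
    SameExpansion m γ δ = ∀ n → sumTo R m (λ k → γ k * b k n) ≈ sumTo R m (λ k → δ k * b k n)

    unique-top : ∀ m γ δ → SameExpansion m γ δ → γ m ≈ δ m
    unique-top m γ δ same = trans (sym (top-coeff m γ)) (trans (same m) (top-coeff m δ))

    -- Cancelling the equal top terms reduces m; induction does the rest.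
    unique : ∀ m γ δ → SameExpansion m γ δ → ∀ k → k ≤ m → γ k ≈ δ k
    unique m γ δ same k k≤m with ℕₚ.m≤n⇒m<n∨m≡n k≤m
    ... | inj₂ P.refl = unique-top m γ δ same
    unique (suc m) γ δ same k k≤m | inj₁ (s≤s k≤m′) = unique m γ δ same′ k k≤m′
      where
      same′ : SameExpansion m γ δ
      same′ n = +-cancelʳ (γ (suc m) * b (suc m) n) _ _
        (trans (same n) (+-cong refl (*-cong (sym (unique-top (suc m) γ δ same)) refl)))

  module Network (x : ℕ → ℕ → Carrier) where

    paths : ℕ → ℕ → ℕ → Carrier
    paths = pathsFrom R x

    -- Edges go right or up, so row m reaches no sink t_j with j > m.
    paths-above : ∀ r m j → m < j → paths m r j ≈ 0#
    paths-above zero m j m<j with m ≟ j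
    ... | yes m≡j = ⊥-elim (ℕₚ.<-irrefl m≡j m<j)
    ... | no  _   = refl
    paths-above (suc r) zero    j m<j = paths-above r zero j m<j
    paths-above (suc r) (suc m) j m<j =
      trans (+-cong (trans (*-identityˡ _) (paths-above r (suc m) j m<j))
                    (trans (*-cong refl (paths-above r m j (ℕₚ.<-trans (ℕₚ.n<1+n m) m<j)))
                           (zeroʳ _)))
            (+-identityˡ 0#)

    paths-last-diag : ∀ m → paths m 0 m ≈ 1#
    paths-last-diag m with m ≟ m
    ... | yes _ = refl
    ... | no m≢m = ⊥-elim (m≢m P.refl)

    paths-last-off : ∀ m j → ¬ m P.≡ j → paths m 0 j ≈ 0#
    paths-last-off m j m≢j with m ≟ j
    ... | yes m≡j = ⊥-elim (m≢j m≡j)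
    ... | no  _   = refl

    pathPoly : (ℕ → Coeffs) → ℕ → ℕ → Coeffs
    pathPoly b m r n = sumTo R m (λ j → paths m r j * b j n)

    pathPoly-last : ∀ b m → pathPoly b m 0 ≋ b m
    pathPoly-last b m n = trans
      (sumTo-last m _ (λ j j<m →
        trans (*-cong (paths-last-off m j (λ m≡j → ℕₚ.<-irrefl (P.sym m≡j) j<m)) refl)
              (zeroˡ _)))
      (trans (*-cong (paths-last-diag m) refl) (*-identityˡ _))

    -- First-step decomposition: a horizontal edge of weight 1 or the
    -- vertical edge below.  The sum over row m extends to m+1 for free.
    pathPoly-step : ∀ b m r → pathPoly b (suc m) (suc r)
                      ≋ λ n → pathPoly b (suc m) r n + x (suc m) (suc m ∸ r) * pathPoly b m r n
    pathPoly-step b m r n = begin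
      sumTo R (suc m) (λ j → (1# * paths (suc m) r j + w * paths m r j) * b j n)
        ≈⟨ sumTo-cong (suc m) (λ j →
             solve 4 (λ u w v y → (con 1 :* u :+ w :* v) :* y := u :* y :+ w :* (v :* y))
               refl (paths (suc m) r j) w (paths m r j) (b j n)) ⟩
      sumTo R (suc m) (λ j → paths (suc m) r j * b j n + w * (paths m r j * b j n))
        ≈⟨ sumTo-+ (suc m) _ _ ⟩
      pathPoly b (suc m) r n + sumTo R (suc m) (λ j → w * (paths m r j * b j n))
        ≈⟨ +-cong refl (sumTo-* (suc m) w _) ⟩
      pathPoly b (suc m) r n + w * sumTo R (suc m) (λ j → paths m r j * b j n)
        ≈⟨ +-cong refl (*-cong refl (sumTo-init m _ top-vanishes)) ⟩
      pathPoly b (suc m) r n + w * pathPoly b m r n ∎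
      where
      w : Carrier
      w = x (suc m) (suc m ∸ r)
      top-vanishes : paths m r (suc m) * b (suc m) n ≈ 0#
      top-vanishes = trans (*-cong (paths-above r m (suc m) (ℕₚ.n<1+n m)) refl) (zeroˡ _)

  module Lemma (a e : ℕ → Carrier) (a₁≈e₁ : a 1 ≈ e 1) where
    open Network (lemmaWeights R a e)

    A E : ℕ → Coeffs
    A k = coeff R (prodLin R a k)
    E k = coeff R (prodLin R e k)

    mulTailE : ℕ → Coeffs → Coeffs
    mulTailE zero    f = f
    mulTailE (suc r) f = mulLin′ (e (suc (suc r))) (mulTailE r f)

    mulTailE-cong : ∀ r {f g} → f ≋ g → mulTailE r f ≋ mulTailE r g
    mulTailE-cong zero    f≋g = f≋g
    mulTailE-cong (suc r) f≋g = mulLin′-cong refl (mulTailE-cong r f≋g)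

    mulTailE-mulLin′ : ∀ r b f → mulTailE r (mulLin′ b f) ≋ mulLin′ b (mulTailE r f)
    mulTailE-mulLin′ zero    b f n = refl
    mulTailE-mulLin′ (suc r) b f n =
      trans (mulLin′-cong refl (mulTailE-mulLin′ r b f) n) (mulLin′-comm _ b _ n)

    -- Since a₁ = e₁, A₁ = E₁ and the tail product completes E₁ to E_{r+1}.
    mulTailE-A₁ : ∀ r → mulTailE r (A 1) ≋ E (suc r)
    mulTailE-A₁ zero n = trans (coeff-mulLin (a 1) (1# ∷ []) n)
      (trans (mulLin′-cong a₁≈e₁ (λ _ → refl) n) (sym (coeff-mulLin (e 1) (1# ∷ []) n)))
    mulTailE-A₁ (suc r) n = trans (mulLin′-cong refl (mulTailE-A₁ r) n)
      (sym (coeff-mulLin (e (suc (suc r))) (prodLin R e (suc r)) n))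

    -- The path polynomial of v(r+d, d+1).
    target : ℕ → ℕ → Coeffs
    target r zero    = E r
    target r (suc d) = mulTailE r (A (suc d))

    -- The weight of the edge leaving v(r+d+1, d+1) downwards.
    weight : ℕ → ℕ → Carrier
    weight r d = lemmaWeights R a e (suc (r +ℕ d)) (suc d)

    column : ∀ r d → suc (r +ℕ d) ∸ r P.≡ suc d
    column zero    d = P.refl
    column (suc r) d = column r d

    weight-higher : ∀ r d → weight r (suc d) ≈ a (suc (suc d)) - e (suc (suc r))
    weight-higher r d = reflexive (P.cong (λ t → a (suc (suc d)) - e t)
      (P.trans (P.cong (_+ℕ 2) (ℕₚ.m+n∸n≡m r (suc d))) (ℕₚ.+-comm r 2)))

    target-step : ∀ r d n → target r (suc d) n + weight r d * target r d n ≈ target (suc r) d n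
    target-step r zero n = begin
      mulTailE r (A 1) n + (a 1 - e 1) * E r n  ≈⟨ +-cong (mulTailE-A₁ r n) (*-cong a₁-e₁≈0 refl) ⟩
      E (suc r) n + 0# * E r n                  ≈⟨ +-cong refl (zeroˡ _) ⟩
      E (suc r) n + 0#                          ≈⟨ +-identityʳ _ ⟩
      E (suc r) n                               ∎
      where
      a₁-e₁≈0 : a 1 - e 1 ≈ 0#
      a₁-e₁≈0 = trans (+-cong a₁≈e₁ refl) (-‿inverseʳ (e 1))
    target-step r (suc d) n = begin
      mulTailE r (A (suc (suc d))) n + weight r (suc d) * G n
        ≈⟨ +-cong lower-a (*-cong (weight-higher r d) refl) ⟩
      mulLin′ a′ G n + (a′ - e (suc (suc r))) * G n
        ≈⟨ change-root a′ (e (suc (suc r))) G n ⟩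
      mulLin′ (e (suc (suc r))) G n ∎
      where
      a′ : Carrier
      a′ = a (suc (suc d))
      G : Coeffs
      G = mulTailE r (A (suc d))
      lower-a : mulTailE r (A (suc (suc d))) n ≈ mulLin′ a′ G n
      lower-a = trans (mulTailE-cong r (coeff-mulLin a′ (prodLin R a (suc d))) n)
                      (mulTailE-mulLin′ r a′ (A (suc d)) n)

    target-start : ∀ d → A d ≋ target 0 d
    target-start zero    n = refl
    target-start (suc d) n = refl

    pathPoly-target : ∀ r d → pathPoly A (r +ℕ d) r ≋ target r d
    pathPoly-target zero    d n = trans (pathPoly-last A d n) (target-start d n)
    pathPoly-target (suc r) d n = begin
      pathPoly A (suc m) (suc r) n
        ≈⟨ pathPoly-step A m r n ⟩
      pathPoly A (suc m) r n + lemmaWeights R a e (suc m) (suc m ∸ r) * pathPoly A m r n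
        ≈⟨ +-cong horizontal (*-cong vertical-weight (pathPoly-target r d n)) ⟩
      target r (suc d) n + weight r d * target r d n
        ≈⟨ target-step r d n ⟩
      target (suc r) d n ∎
      where
      m : ℕ
      m = r +ℕ d
      horizontal : pathPoly A (suc m) r n ≈ target r (suc d) n
      horizontal = P.subst (λ k → pathPoly A k r n ≈ target r (suc d) n)
                           (ℕₚ.+-suc r d) (pathPoly-target r (suc d) n)
      vertical-weight : lemmaWeights R a e (suc m) (suc m ∸ r) ≈ weight r d
      vertical-weight = reflexive (P.cong (lemmaWeights R a e (suc m)) (column r d))

    pathPoly-first : ∀ i → pathPoly A i i ≋ E i
    pathPoly-first i n = P.subst (λ k → pathPoly A k i n ≈ E i n)
                                 (ℕₚ.+-identityʳ i) (pathPoly-target i 0 n)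

-- Both rows i of the path matrix and of S^{a,e} expand E_i in the monic
-- basis (A_k); by uniqueness of such expansions they coincide.
lemma3p7 : {c ℓ : Level} (R : CommutativeRing c ℓ)
    (a e : ℕ → CommutativeRing.Carrier R)
    (S : ℕ → ℕ → CommutativeRing.Carrier R) →
    CommutativeRing._≈_ R (a 1) (e 1) →
    IsSae R a e S →
    (i j : ℕ) →
    CommutativeRing._≈_ R (pathMatrix R (lemmaWeights R a e) i j) (S i j)
lemma3p7 R a e S a₁≈e₁ sae i j = entry (j ≤? i)
  where
  open CommutativeRing R hiding (zero)
  open Development R
  open Network (lemmaWeights R a e)
  open Lemma a e a₁≈e₁
  open MonicBasis A (prodLin-leading a) (prodLin-above a)

  same-expansion : ∀ n → sumTo R i (λ k → paths i i k * A k n) ≈ sumTo R i (λ k → S i k * A k n)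
  same-expansion n = trans (pathPoly-first i n) (proj₂ (sae i) n)

  entry : Dec (j ≤ i) → pathMatrix R (lemmaWeights R a e) i j ≈ S i j
  entry (yes j≤i) = trans (*-identityˡ _) (unique i (paths i i) (S i) same-expansion j j≤i)
  entry (no  j≰i) = trans (*-identityˡ _)
    (trans (paths-above i i j i<j) (sym (proj₁ (sae i) j i<j)))
    where
    i<j : i < j
    i<j = ℕₚ.≰⇒> j≰i
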